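{- Let $\varphi$ be a realizable LTL formula over input variables $I$ and output variables $O$, and let $A = (\Sigma_I \times \Sigma_O, Q, \delta, q_0, F)$ be a nondeterministic Büchi automaton with $L(A) = L(\varphi)$ in which every state and transition lies on an accepting run. Let $X \subseteq O$ be a maximal dependent set in $\varphi$ and $Y = I \cup (O \setminus X)$. Let $A'$ be the NBA over $\Sigma_Y = \Sigma_I \times \Sigma_{O \setminus X}$ with the same states, initial state and accepting states as $A$, and with $q' \in \delta'(q,\tau)$ iff there is $\sigma' \in \Sigma_X$ with $q' \in \delta(q,(\tau,\sigma'))$. Let $T_Y$ be a transducer with input alphabet $\Sigma_I$ and output alphabet $\Sigma_{O\setminus X}$ realizing $L(A')$ (i.e., every word over $\Sigma_Y$ it generates lies in $L(A')$). Let $T_X$ be the transducer with input alphabet $\Sigma_Y$, output alphabet $\Sigma_X \cup \{\bot\}$, state set $2^Q$, initial state $\{q_0\}$, transition function $\delta^X(U,(\sigma_I,\sigma)) = \{q' \mid \exists q \in U\ \exists \sigma' \in \Sigma_X: q' \in \delta(q,(\sigma_I,\sigma,\sigma'))\}$, and output function $\lambda^X(U,(\sigma_I,\sigma))$ equal to the unique $\sigma_X \in \Sigma_X$ with $\delta^X(U,(\sigma_I,\sigma)) = \{q' \mid \exists q \in U: q' \in \delta(q,(\sigma_I,\sigma,\sigma_X))\}$ when $\delta^X(U,(\sigma_I,\sigma)) \neq \emptyset$, and $\bot$ otherwise. Let $T$ be the composition in which, on each input letter $\sigma_I$, $T_Y$ produces $\sigma \in \Sigma_{O \setminus X}$, then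 $T_X$ reads $(\sigma_I,\sigma)$ and produces $\sigma_X$, and $T$ outputs $(\sigma,\sigma_X) \in \Sigma_O$. Then $T$ realizes $\varphi$: every word in $(\Sigma_I \times \Sigma_O)^\omega$ generated by $T$ belongs to $L(\varphi)$.
   Context: $\Sigma_Z = 2^Z$ (assignments to $Z$); letters of $\Sigma_I \times \Sigma_O$ are written $(\sigma_I,\sigma,\sigma')$ with $\sigma \in \Sigma_{O\setminus X}$, $\sigma' \in \Sigma_X$. A transducer (Mealy machine) $(\Sigma_{in},\Sigma_{out},S,s_0,\delta_T,\lambda)$ has deterministic $\delta_T : S \times \Sigma_{in} \to S$ and output $\lambda : S \times \Sigma_{in} \to \Sigma_{out}$; on input $a_0a_1\cdots$ it produces the word $(a_0,b_0)(a_1,b_1)\cdots$ with $b_j = \lambda(s_j,a_j)$, $s_{j+1} = \delta_T(s_j,a_j)$. $\varphi$ is realizable if there is a strategy $f : \Sigma_I^* \to \Sigma_O$ (equivalently a transducer) such that every word it generates is in $L(\varphi)$. For an infinite word $w$, $w[0,i] = w_0\cdots w_i$, $w[0,-1]$ is empty, and $a.Z$ is the restriction of letter $a$ to $Z$. $X$ is dependent in $\varphi$ if for all $w,w' \in L(\varphi)$, $i \ge 0$: $w[0,i-1]=w'[0,i-1]$ and $w_i.(V\setminus X) = w'_i.(V\setminus X)$ imply $w_i.X = w'_i.X$, where $V = I\cup O$; $X$ is a maximal dependent set if it is dependent in $\varphi$ and no $X' \subseteq O$ strictly containing $X$ is dependent in $\varphi$. (Under these hypotheses the $\sigma_X$ in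 the definition of $\lambda^X$ is unique on reachable states.) -}

module Defs where

open import Level using (Level; 0ℓ; _⊔_) renaming (suc to lsuc)
open import Data.Nat using (ℕ; zero; suc; _≤_; _<_)
open import Data.Fin using (Fin)
open import Data.Bool using (Bool; true; false; not; T)
open import Data.Unit using (tt; ⊤)
open import Data.Vec using (Vec; lookup; tabulate)
open import Data.List using (List; map; upTo)
open import Data.Maybe using (Maybe; just; nothing)
import Data.Maybe as Maybe
open import Data.Product using (Σ; Σ-syntax; ∃; ∃-syntax; _×_; _,_; proj₁; proj₂)
open import Data.Sum using (_⊎_; inj₁; inj₂)
open import Relation.Nullary using (¬_)
open import Relation.Binary.PropositionalEquality using (_≡_)

Word : Set → Set
Word A = ℕ → A

prefix : {A : Set} → Word A → ℕ → List A
prefix w n = map w (upTo n)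

-- Input variables I = Fin nI, output variables O = Fin nO.
-- Σ_I = 2^I and Σ_O = 2^O are represented as Bool-vectors (assignments).
-- A subset Z ⊆ O is a predicate Fin nO → Bool, and Σ_Z = 2^Z is the type
-- of assignments of a truth value to each variable of Z.

ΣI : ℕ → Set
ΣI nI = Vec Bool nI

ΣO : ℕ → Set
ΣO nO = Vec Bool nO

Letter : ℕ → ℕ → Set
Letter nI nO = ΣI nI × ΣO nO

Subset : ℕ → Set
Subset n = Fin n → Bool

co : {n : ℕ} → Subset n → Subset n
co Z v = not (Z v)

Val : {n : ℕ} → Subset n → Set
Val {n} Z = (v : Fin n) → T (Z v) → Bool

_≈V_ : {n : ℕ} {Z : Subset n} → Val Z → Val Z → Set
_≈V_ {n} {Z} σ τ = (v : Fin n) (p : T (Z v)) → σ v p ≡ τ v p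

pick : (b : Bool) → (T (not b) → Bool) → (T b → Bool) → Bool
pick false f g = f tt
pick true  f g = g tt

comb : {n : ℕ} (X : Subset n) → Val (co X) → Val X → Vec Bool n
comb X σ σ' = tabulate (λ v → pick (X v) (σ v) (σ' v))

data LTL (nI nO : ℕ) : Set where
  ltrue : LTL nI nO
  inp   : Fin nI → LTL nI nO
  outp  : Fin nO → LTL nI nO
  lnot  : LTL nI nO → LTL nI nO
  land  : LTL nI nO → LTL nI nO → LTL nI nO
  next  : LTL nI nO → LTL nI nO
  until : LTL nI nO → LTL nI nO → LTL nI nO

Sat : {nI nO : ℕ} → Word (Letter nI nO) → ℕ → LTL nI nO → Set
Sat w i ltrue = ⊤
Sat w i (inp p) = lookup (proj₁ (w i)) p ≡ true
Sat w i (outp p) = lookup (proj₂ (w i)) p ≡ true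
Sat w i (lnot φ) = ¬ Sat w i φ
Sat w i (land φ ψ) = Sat w i φ × Sat w i ψ
Sat w i (next φ) = Sat w (suc i) φ
Sat w i (until φ ψ) =
  ∃[ k ] (i ≤ k × Sat w k ψ × ((j : ℕ) → i ≤ j → j < k → Sat w j φ))

InL : {nI nO : ℕ} → LTL nI nO → Word (Letter nI nO) → Set
InL φ w = Sat w 0 φ

-- Realizability: a strategy f : Σ_I^* → Σ_O; on input w the output at
-- step j is f (w_0 ⋯ w_j).

Realizable : {nI nO : ℕ} → LTL nI nO → Set
Realizable {nI} {nO} φ =
  Σ[ f ∈ (List (ΣI nI) → ΣO nO) ]
    ((w : Word (ΣI nI)) → InL φ (λ j → (w j , f (prefix w (suc j)))))

Dependent : {nI nO : ℕ} → LTL nI nO → Subset nO → Set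
Dependent {nI} {nO} φ X =
  (w w' : Word (Letter nI nO)) → InL φ w → InL φ w' → (i : ℕ) →
  ((k : ℕ) → k < i → w k ≡ w' k) →
  proj₁ (w i) ≡ proj₁ (w' i) →
  ((o : Fin nO) → X o ≡ false → lookup (proj₂ (w i)) o ≡ lookup (proj₂ (w' i)) o) →
  (o : Fin nO) → X o ≡ true → lookup (proj₂ (w i)) o ≡ lookup (proj₂ (w' i)) o

MaximalDependent : {nI nO : ℕ} → LTL nI nO → Subset nO → Set
MaximalDependent {nI} {nO} φ X =
  Dependent φ X ×
  ((X' : Subset nO) →
     ((o : Fin nO) → X o ≡ true → X' o ≡ true) →
     (∃[ o ] (X' o ≡ true × X o ≡ false)) →
     ¬ Dependent φ X')

record NBA (Γ : Set) : Set₁ where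
  field
    m  : ℕ
    δ  : Fin m → Γ → Fin m → Set
    q₀ : Fin m
    F  : Fin m → Set

module _ {Γ : Set} (A : NBA Γ) where
  open NBA A

  IsRun : Word Γ → Word (Fin m) → Set
  IsRun w r = (r 0 ≡ q₀) × ((j : ℕ) → δ (r j) (w j) (r (suc j)))

  Accepting : Word (Fin m) → Set
  Accepting r = (n : ℕ) → ∃[ k ] (n ≤ k × F (r k))

  InLA : Word Γ → Set
  InLA w = Σ[ r ∈ Word (Fin m) ] (IsRun w r × Accepting r)

  Trim : Set
  Trim =
    ((q : Fin m) → Σ[ w ∈ Word Γ ] Σ[ r ∈ Word (Fin m) ]
        (IsRun w r × Accepting r × ∃[ j ] (r j ≡ q)))
    ×
    ((q : Fin m) (a : Γ) (q' : Fin m) → δ q a q' →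
       Σ[ w ∈ Word Γ ] Σ[ r ∈ Word (Fin m) ]
         (IsRun w r × Accepting r ×
          ∃[ j ] (r j ≡ q × w j ≡ a × r (suc j) ≡ q')))

ΣY : (nI : ℕ) {nO : ℕ} → Subset nO → Set
ΣY nI X = ΣI nI × Val (co X)

project : {nI nO : ℕ} → (X : Subset nO) → NBA (Letter nI nO) → NBA (ΣY nI X)
project X A = record
  { m  = NBA.m A
  ; δ  = λ q τ q' → Σ[ σ' ∈ Val X ] NBA.δ A q (proj₁ τ , comb X (proj₂ τ) σ') q'
  ; q₀ = NBA.q₀ A
  ; F  = NBA.F A
  }

record Transducer (ℓ : Level) (In Out : Set) : Set (lsuc ℓ) where
  field
    S  : Set ℓ
    s₀ : S
    δT : S → In → S
    λT : S → In → Out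

module _ {ℓ : Level} {In Out : Set} (M : Transducer ℓ In Out) where
  open Transducer M

  stateAt : Word In → ℕ → S
  stateAt w zero    = s₀
  stateAt w (suc j) = δT (stateAt w j) (w j)

  outAt : Word In → ℕ → Out
  outAt w j = λT (stateAt w j) (w j)

  generated : Word In → Word (In × Out)
  generated w j = (w j , outAt w j)

Realizes : {ℓ : Level} {In Out : Set} → Transducer ℓ In Out → (Word (In × Out) → Set) → Set
Realizes {In = In} M P = (w : Word In) → P (generated M w)

module _ {nI nO : ℕ} (A : NBA (Letter nI nO)) (X : Subset nO) where
  open NBA A

  δX : (Fin m → Set) → ΣY nI X → (Fin m → Set)
  δX U (σI , σ) q' = ∃[ q ] (U q × Σ[ σ' ∈ Val X ] δ q (σI , comb X σ σ') q')

  δXwith : (Fin m → Set) → ΣY nI X → Val X → (Fin m → Set)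
  δXwith U (σI , σ) σX q' = ∃[ q ] (U q × δ q (σI , comb X σ σX) q')

  SetEq : (Fin m → Set) → (Fin m → Set) → Set
  SetEq P R = (q : Fin m) → (P q → R q) × (R q → P q)

  -- λ^X is "the unique σ_X with δ^X(U,a) = δXwith U a σ_X" when δ^X(U,a) ≠ ∅,
  -- and ⊥ (= nothing) otherwise.
  IsLambdaX : ((Fin m → Set) → ΣY nI X → Maybe (Val X)) → Set₁
  IsLambdaX lamX =
    ((U : Fin m → Set) (a : ΣY nI X) →
       ¬ (∃[ q' ] δX U a q') → lamX U a ≡ nothing)
    ×
    ((U : Fin m → Set) (a : ΣY nI X) →
       (∃[ q' ] δX U a q') →
       (σX : Val X) → SetEq (δX U a) (δXwith U a σX) →
       ((σX' : Val X) → SetEq (δX U a) (δXwith U a σX') → σX' ≈V σX) →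
       Σ[ τ ∈ Val X ] (lamX U a ≡ just τ × τ ≈V σX))

  TX : ((Fin m → Set) → ΣY nI X → Maybe (Val X)) →
       Transducer (lsuc 0ℓ) (ΣY nI X) (Maybe (Val X))
  TX lamX = record
    { S  = Fin m → Set
    ; s₀ = λ q → q ≡ q₀
    ; δT = δX
    ; λT = lamX
    }

compose : {nI nO : ℕ} (X : Subset nO) →
          Transducer 0ℓ (ΣI nI) (Val (co X)) →
          Transducer (lsuc 0ℓ) (ΣY nI X) (Maybe (Val X)) →
          Transducer (lsuc 0ℓ) (ΣI nI) (Maybe (ΣO nO))
compose X TY TXm = record
  { S  = SY × SX
  ; s₀ = (s₀Y , s₀X)
  ; δT = λ { (s , U) σI → (δY s σI , δX' U (σI , λY s σI)) }
  ; λT = λ { (s , U) σI → Maybe.map (comb X (λY s σI)) (λX' U (σI , λY s σI)) }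
  }
  where
    open Transducer TY renaming (S to SY; s₀ to s₀Y; δT to δY; λT to λY)
    open Transducer TXm renaming (S to SX; s₀ to s₀X; δT to δX'; λT to λX')

{-# OPTIONS --safe #-}
module Submission where

-- The word produced by T_Y is accepted by A', so its accepting run lifts to a
-- word u = (w_j , σ_j , σ'_j)_j of L(A) = L(φ).  The subset construction T_X,
-- fed with (w_j , σ_j), is always in exactly the set of states A can reach on
-- u_0 ⋯ u_{j-1}.  A transition of A out of such a state lies on an accepting
-- run (A is trim), so grafting that run after u_0 ⋯ u_{j-1} gives a second
-- word of L(φ) agreeing with u before position j; if its letter at j agrees
-- with u_j off X, dependence of X forces it to agree on X as well.  Hence the
-- only σ_X usable by A at step j is σ'_j, λ^X outputs it, and T generates u.

open import Defs
open import Level using (0ℓ) renaming (suc to lsuc)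
open import Data.Nat using (ℕ; zero; suc; _+_; _∸_; _<_)
open import Data.Nat.Properties
  using (+-identityʳ; +-suc; m<1+n⇒m<n∨m≡n; m≤n⇒m≤1+n; m+n≤o⇒m≤o∸n; m+n≤o⇒n≤o; m∸n+n≡m)
open import Data.Fin using (Fin)
open import Data.Bool using (Bool; true; false; not; T)
open import Data.Bool.Properties using (T-≡)
open import Data.Unit using (tt)
open import Data.Maybe using (Maybe; just)
import Data.Maybe as Maybe
open import Data.Vec using (Vec; lookup)
open import Data.Vec.Properties using (lookup∘tabulate; tabulate-cong)
open import Data.Product using (Σ-syntax; ∃-syntax; _×_; _,_; proj₁; proj₂)
open import Data.Sum using (inj₁; inj₂)
open import Function.Bundles using (_⇔_; Equivalence)
open import Relation.Binary.PropositionalEquality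
  using (_≡_; refl; sym; trans; cong; subst; module ≡-Reasoning)

open ≡-Reasoning

infixr 5 _∷ʷ_

_∷ʷ_ : {A : Set} → A → Word A → Word A
(a ∷ʷ w) zero    = a
(a ∷ʷ w) (suc j) = w j

-- Indexing by k + n makes suffix w n 0 reduce to w n, so shifted runs need no rewriting.
suffix : {A : Set} → Word A → ℕ → Word A
suffix w n k = w (k + n)

-- splice u j v = u_0 ⋯ u_{j-1} v_0 v_1 ⋯
splice : {A : Set} → Word A → ℕ → Word A → Word A
splice u zero    v = v
splice u (suc j) v = splice u j (u j ∷ʷ v)

splice-suffix : {A : Set} (u : Word A) (j : ℕ) (v : Word A) (k : ℕ) →
                splice u j v (k + j) ≡ v k
splice-suffix u zero    v k = cong v (+-identityʳ k)
splice-suffix u (suc j) v k =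
  trans (cong (splice u j (u j ∷ʷ v)) (+-suc k j)) (splice-suffix u j (u j ∷ʷ v) (suc k))

splice-prefix : {A : Set} (u : Word A) (j : ℕ) (v : Word A) {k : ℕ} →
                k < j → splice u j v k ≡ u k
splice-prefix u (suc j) v {k} k<1+j with m<1+n⇒m<n∨m≡n k<1+j
... | inj₁ k<j  = splice-prefix u j (u j ∷ʷ v) k<j
... | inj₂ refl = splice-suffix u k (u k ∷ʷ v) 0

module _ {Γ : Set} (A : NBA Γ) where
  open NBA A

  IsRunFrom : Fin m → Word Γ → Word (Fin m) → Set
  IsRunFrom q w r = r 0 ≡ q × ((j : ℕ) → δ (r j) (w j) (r (suc j)))

  AcceptedFrom : Fin m → Word Γ → Set
  AcceptedFrom q w = Σ[ r ∈ Word (Fin m) ] (IsRunFrom q w r × Accepting A r)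

  accepting-∷ʷ : (q : Fin m) {r : Word (Fin m)} → Accepting A r → Accepting A (q ∷ʷ r)
  accepting-∷ʷ q acc n with acc n
  ... | k , n≤k , Fk = suc k , m≤n⇒m≤1+n n≤k , Fk

  accepting-suffix : {r : Word (Fin m)} (n : ℕ) → Accepting A r → Accepting A (suffix r n)
  accepting-suffix {r} n acc i with acc (i + n)
  ... | k , i+n≤k , Fk =
    k ∸ n , m+n≤o⇒m≤o∸n i i+n≤k , subst F (cong r (sym (m∸n+n≡m (m+n≤o⇒n≤o i i+n≤k)))) Fk

  suffix-acceptedFrom : {q : Fin m} {w : Word Γ} {r : Word (Fin m)} →
                        IsRunFrom q w r → Accepting A r → (n : ℕ) →
                        AcceptedFrom (r n) (suffix w n)
  suffix-acceptedFrom {r = r} (_ , run) acc n =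
    suffix r n , (refl , λ k → run (k + n)) , accepting-suffix n acc

  trim-transition-acceptedFrom : Trim A → {q : Fin m} {a : Γ} {q′ : Fin m} → δ q a q′ →
                                 Σ[ v ∈ Word Γ ] (AcceptedFrom q v × v 0 ≡ a)
  trim-transition-acceptedFrom (_ , transition-on-run) t with transition-on-run _ _ _ t
  ... | w , r , run , acc , j , refl , refl , _ = suffix w j , suffix-acceptedFrom run acc j , refl

  data Reachable (u : Word Γ) : ℕ → Fin m → Set where
    start : Reachable u 0 q₀
    step  : {j : ℕ} {q q′ : Fin m} → Reachable u j q → δ q (u j) q′ → Reachable u (suc j) q′

  run⇒reachable : {u : Word Γ} {r : Word (Fin m)} → IsRun A u r → (j : ℕ) → Reachable u j (r j)
  run⇒reachable (r0 , _)   zero    = subst (Reachable _ 0) (sym r0) start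
  run⇒reachable (r0 , run) (suc j) = step (run⇒reachable (r0 , run) j) (run j)

  splice-accepted : {u : Word Γ} {j : ℕ} {q : Fin m} {v : Word Γ} →
                    Reachable u j q → AcceptedFrom q v → InLA A (splice u j v)
  splice-accepted start acc = acc
  splice-accepted {u} {v = v} (step {j} {q} R t) (r , (r0 , run) , acc) =
    splice-accepted R (q ∷ʷ r , (refl , run′) , accepting-∷ʷ q acc)
    where
    run′ : (k : ℕ) → δ ((q ∷ʷ r) k) ((u j ∷ʷ v) k) ((q ∷ʷ r) (suc k))
    run′ zero    = subst (δ q (u j)) (sym r0) t
    run′ (suc k) = run k

  reachable-transition-splice :
    Trim A → {u : Word Γ} {j : ℕ} {q : Fin m} {a : Γ} {q′ : Fin m} →
    Reachable u j q → δ q a q′ →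
    Σ[ v ∈ Word Γ ] (InLA A v × ((k : ℕ) → k < j → v k ≡ u k) × v j ≡ a)
  reachable-transition-splice trim {u} {j} R t with trim-transition-acceptedFrom trim t
  ... | v , acc , v0≡a =
    splice u j v , splice-accepted R acc , (λ k → splice-prefix u j v) , trans (splice-suffix u j v 0) v0≡a

pick-congʳ : (b : Bool) {f : T (not b) → Bool} {g g′ : T b → Bool} →
             ((p : T b) → g p ≡ g′ p) → pick b f g ≡ pick b f g′
pick-congʳ false g≗g′ = refl
pick-congʳ true  g≗g′ = g≗g′ tt

pick-irrelevantʳ : {b : Bool} (f : T (not b) → Bool) (g g′ : T b → Bool) →
                   b ≡ false → pick b f g ≡ pick b f g′
pick-irrelevantʳ f g g′ refl = refl

pick-injectiveʳ : (b : Bool) (f : T (not b) → Bool) (g g′ : T b → Bool) (p : T b) →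
                  pick b f g ≡ pick b f g′ → g p ≡ g′ p
pick-injectiveʳ true f g g′ tt eq = eq

module _ {n : ℕ} (X : Subset n) where

  AgreeWhere : Bool → Vec Bool n → Vec Bool n → Set
  AgreeWhere b o o′ = (v : Fin n) → X v ≡ b → lookup o v ≡ lookup o′ v

  comb-cong : (σ : Val (co X)) {τ τ′ : Val X} → τ ≈V τ′ → comb X σ τ ≡ comb X σ τ′
  comb-cong σ τ≈τ′ = tabulate-cong λ v → pick-congʳ (X v) (τ≈τ′ v)

  comb-agree-off : (σ : Val (co X)) (τ τ′ : Val X) → AgreeWhere false (comb X σ τ) (comb X σ τ′)
  comb-agree-off σ τ τ′ v Xv≡false = begin
    lookup (comb X σ τ) v        ≡⟨ lookup∘tabulate _ v ⟩
    pick (X v) (σ v) (τ v)       ≡⟨ pick-irrelevantʳ (σ v) (τ v) (τ′ v) Xv≡false ⟩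
    pick (X v) (σ v) (τ′ v)      ≡⟨ lookup∘tabulate _ v ⟨
    lookup (comb X σ τ′) v       ∎

  comb-injectiveʳ : (σ : Val (co X)) (τ τ′ : Val X) →
                    AgreeWhere true (comb X σ τ) (comb X σ τ′) → τ ≈V τ′
  comb-injectiveʳ σ τ τ′ agree v p = pick-injectiveʳ (X v) (σ v) (τ v) (τ′ v) p (begin
    pick (X v) (σ v) (τ v)       ≡⟨ lookup∘tabulate _ v ⟨
    lookup (comb X σ τ) v        ≡⟨ agree v (Equivalence.to T-≡ p) ⟩
    lookup (comb X σ τ′) v       ≡⟨ lookup∘tabulate _ v ⟩
    pick (X v) (σ v) (τ′ v)      ∎)

dependent-comb : {nI nO : ℕ} {φ : LTL nI nO} {X : Subset nO} → Dependent φ X →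
                 {v u : Word (Letter nI nO)} {j : ℕ}
                 {σI : ΣI nI} {σ : Val (co X)} {τ τ′ : Val X} →
                 InL φ v → InL φ u → ((k : ℕ) → k < j → v k ≡ u k) →
                 v j ≡ (σI , comb X σ τ) → u j ≡ (σI , comb X σ τ′) → τ ≈V τ′
dependent-comb {X = X} dep {v} {u} {j} {σ = σ} {τ} {τ′} vφ uφ agree vj uj =
  comb-injectiveʳ X σ τ τ′ λ o Xo → begin
    lookup (comb X σ τ) o        ≡⟨ outputAt-cong o vj ⟨
    lookup (proj₂ (v j)) o       ≡⟨ dep v u vφ uφ j agree (trans (cong proj₁ vj) (cong proj₁ (sym uj))) agree-off o Xo ⟩
    lookup (proj₂ (u j)) o       ≡⟨ outputAt-cong o uj ⟩
    lookup (comb X σ τ′) o       ∎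
  where
  outputAt-cong : ∀ o {a b} → a ≡ b → lookup (proj₂ a) o ≡ lookup (proj₂ b) o
  outputAt-cong o = cong λ a → lookup (proj₂ a) o

  agree-off : AgreeWhere X false (proj₂ (v j)) (proj₂ (u j))
  agree-off o Xo = begin
    lookup (proj₂ (v j)) o       ≡⟨ outputAt-cong o vj ⟩
    lookup (comb X σ τ) o        ≡⟨ comb-agree-off X σ τ τ′ o Xo ⟩
    lookup (comb X σ τ′) o       ≡⟨ outputAt-cong o uj ⟨
    lookup (proj₂ (u j)) o       ∎

project-lift : {nI nO : ℕ} (X : Subset nO) (A : NBA (Letter nI nO)) {y : Word (ΣY nI X)} →
               InLA (project X A) y →
               Σ[ σ′ ∈ Word (Val X) ] InLA A (λ j → (proj₁ (y j) , comb X (proj₂ (y j)) (σ′ j)))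
project-lift X A (r , (r0 , run) , acc) = (λ j → proj₁ (run j)) , r , (r0 , λ j → proj₂ (run j)) , acc

module _ {nI nO : ℕ} (A : NBA (Letter nI nO)) (X : Subset nO) where
  open NBA A

  Forces : (Fin m → Set) → ΣY nI X → Val X → Set
  Forces U (σI , σ) σX = {q : Fin m} {τ : Val X} {q′ : Fin m} → U q → δ q (σI , comb X σ τ) q′ → τ ≈V σX

  δX⊆δXwith : (U : Fin m → Set) (a : ΣY nI X) (σX : Val X) → Forces U a σX →
              (q′ : Fin m) → δX A X U a q′ → δXwith A X U a σX q′
  δX⊆δXwith U (σI , σ) σX forces q′ (q , Uq , τ , t) =
    q , Uq , subst (λ o → δ q (σI , o) q′) (comb-cong X σ (forces Uq t)) t

  lamX-forced : {lamX : (Fin m → Set) → ΣY nI X → Maybe (Val X)} → IsLambdaX A X lamX →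
                (U : Fin m → Set) (a : ΣY nI X) (σX : Val X) → Forces U a σX →
                ∃[ q′ ] δXwith A X U a σX q′ →
                Σ[ τ ∈ Val X ] (lamX U a ≡ just τ × τ ≈V σX)
  lamX-forced (_ , lamX-unique) U a@(_ , _) σX forces (q′ , q , Uq , t) =
    lamX-unique U a (q′ , q , Uq , σX , t) σX
      (λ p → δX⊆δXwith U a σX forces p , λ { (p , Up , tp) → p , Up , σX , tp })
      unique
    where
    unique : (σX′ : Val X) → SetEq A X (δX A X U a) (δXwith A X U a σX′) → σX′ ≈V σX
    unique σX′ same with proj₁ (same q′) (q , Uq , σX , t)
    ... | p , Up , tp = forces Up tp

module _ {nI nO : ℕ} {φ : LTL nI nO} {A : NBA (Letter nI nO)} {X : Subset nO}
         (sound : (w : Word (Letter nI nO)) → InLA A w → InL φ w) (trim : Trim A)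
         (dep : Dependent φ X) where
  open NBA A

  reachable-transition-determined :
    {u : Word (Letter nI nO)} {j : ℕ} {q q′ : Fin m}
    {σI : ΣI nI} {σ : Val (co X)} {τ τ′ : Val X} →
    InL φ u → Reachable A u j q → δ q (σI , comb X σ τ) q′ → u j ≡ (σI , comb X σ τ′) → τ ≈V τ′
  reachable-transition-determined uφ R t uj with reachable-transition-splice A trim R t
  ... | v , vA , agree , vj = dependent-comb {φ = φ} dep (sound v vA) uφ agree vj uj

  module _ (lamX : (Fin m → Set) → ΣY nI X → Maybe (Val X))
           (w : Word (ΣI nI)) (σ : Word (Val (co X))) (σ′ : Word (Val X))
           (uφ : InL φ (λ j → (w j , comb X (σ j) (σ′ j)))) where
    private
      u : Word (Letter nI nO)
      u j = (w j , comb X (σ j) (σ′ j))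

      y : Word (ΣY nI X)
      y j = (w j , σ j)

      U : ℕ → Fin m → Set
      U = stateAt (TX A X lamX) y

    state⇒reachable : (j : ℕ) {q : Fin m} → U j q → Reachable A u j q
    state-forces    : (j : ℕ) → Forces A X (U j) (y j) (σ′ j)

    state⇒reachable zero    refl = start
    state⇒reachable (suc j) {q′} Uq′ with δX⊆δXwith A X (U j) (y j) (σ′ j) (state-forces j) q′ Uq′
    ... | q , Uq , t = step (state⇒reachable j Uq) t

    state-forces j Uq t = reachable-transition-determined uφ (state⇒reachable j Uq) t refl

    reachable⇒state : {j : ℕ} {q : Fin m} → Reachable A u j q → U j q
    reachable⇒state start              = refl
    reachable⇒state (step {j} {q} R t) = q , reachable⇒state R , σ′ j , t

    outAt-TX : IsLambdaX A X lamX → {r : Word (Fin m)} → IsRun A u r → (j : ℕ) →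
               Σ[ τ ∈ Val X ] (outAt (TX A X lamX) y j ≡ just τ × τ ≈V σ′ j)
    outAt-TX isL run j =
      lamX-forced A X isL (U j) (y j) (σ′ j) (state-forces j)
        (_ , _ , reachable⇒state (run⇒reachable A run j) , proj₂ run j)

module _ {nI nO : ℕ} (X : Subset nO) (TY : Transducer 0ℓ (ΣI nI) (Val (co X)))
         (TXm : Transducer (lsuc 0ℓ) (ΣY nI X) (Maybe (Val X))) (w : Word (ΣI nI)) where
  private
    y : Word (ΣY nI X)
    y j = (w j , outAt TY w j)

  stateAt-compose : (j : ℕ) → stateAt (compose X TY TXm) w j ≡ (stateAt TY w j , stateAt TXm y j)
  stateAt-compose zero    = refl
  stateAt-compose (suc j) = cong (λ s → Transducer.δT (compose X TY TXm) s (w j)) (stateAt-compose j)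

  outAt-compose : (j : ℕ) →
                  outAt (compose X TY TXm) w j ≡ Maybe.map (comb X (outAt TY w j)) (outAt TXm y j)
  outAt-compose j = cong (λ s → Transducer.λT (compose X TY TXm) s (w j)) (stateAt-compose j)

theorem3 : {nI nO : ℕ} (φ : LTL nI nO) → Realizable φ →
    (A : NBA (Letter nI nO)) → ((w : Word (Letter nI nO)) → InLA A w ⇔ InL φ w) → Trim A →
    (X : Subset nO) → MaximalDependent φ X →
    (TY : Transducer 0ℓ (ΣI nI) (Val (co X))) → Realizes TY (InLA (project X A)) →
    (lamX : (Fin (NBA.m A) → Set) → ΣY nI X → Maybe (Val X)) → IsLambdaX A X lamX →
    (w : Word (ΣI nI)) →
      Σ[ o ∈ Word (ΣO nO) ]
        (((j : ℕ) → outAt (compose X TY (TX A X lamX)) w j ≡ just (o j))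
         × InL φ (λ j → (w j , o j)))
theorem3 {nI} {nO} φ _ A A⇔φ trim X (dep , _) TY realizesY lamX isL w
  with project-lift X A (realizesY w)
... | σ′ , uA@(_ , run , _) = (λ j → comb X (σ j) (σ′ j)) , outputs , uφ
  where
  sound : (v : Word (Letter nI nO)) → InLA A v → InL φ v
  sound v = Equivalence.to (A⇔φ v)

  σ : Word (Val (co X))
  σ = outAt TY w

  uφ : InL φ (λ j → (w j , comb X (σ j) (σ′ j)))
  uφ = sound _ uA

  outputs : (j : ℕ) → outAt (compose X TY (TX A X lamX)) w j ≡ just (comb X (σ j) (σ′ j))
  outputs j with outAt-TX {φ = φ} {A = A} sound trim dep lamX w σ σ′ uφ isL run j
  ... | τ , out≡τ , τ≈σ′ = begin
    outAt (compose X TY (TX A X lamX)) w j                  ≡⟨ outAt-compose X TY (TX A X lamX) w j ⟩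
    Maybe.map (comb X (σ j)) (outAt (TX A X lamX) _ j)       ≡⟨ cong (Maybe.map (comb X (σ j))) out≡τ ⟩
    just (comb X (σ j) τ)                                    ≡⟨ cong just (comb-cong X (σ j) τ≈σ′) ⟩
    just (comb X (σ j) (σ′ j))                               ∎
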